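{- $\mathcal{WN}_{\beta\mu\mu'\rho\varepsilon}\subseteq\mathcal{WN}_{\beta\mu\mu'\rho\varepsilon\theta}$.
   Context: $\lambda\mu$-terms: $\mathcal{T} ::= x \mid \lambda x.\mathcal{T} \mid (\mathcal{T})\mathcal{T} \mid [\alpha]\mathcal{T} \mid \mu\alpha.\mathcal{T}$ ($x$ $\lambda$-variables, $\alpha$ $\mu$-variables), up to renaming of bound variables; substitutions avoid capture. $M[x:=N]$ usual substitution; $M[\alpha:=\beta]$ renames free $\alpha$ to $\beta$; $M[\alpha:=_rN]$ (resp. $M[\alpha:=_lN]$) replaces inductively every subterm $[\alpha]P$ by $[\alpha](P')N$ (resp. $[\alpha](N)P'$), $P'$ the substituted $P$; $M_\alpha$ replaces inductively every subterm $[\alpha]P$ by $P$. Rules: $\beta$: $(\lambda x.M)N\to M[x:=N]$; $\mu$: $(\mu\alpha.M)N\to\mu\alpha.M[\alpha:=_rN]$; $\mu'$: $(N)\mu\alpha.M\to\mu\alpha.M[\alpha:=_lN]$; $\rho$: $[\beta]\mu\alpha.M\to M[\alpha:=\beta]$; $\theta$: $\mu\alpha.[\alpha]M\to M$ if $\alpha\notin\mathrm{fv}(M)$; $\varepsilon$: $\mu\alpha.\mu\beta.M\to\mu\alpha.M_\beta$. For a set $\mathcal{R}$ of rules, a one-step $\mathcal{R}$-reduction contracts one $\mathcal{R}$-redex anywhere in a term; $\mathcal{WN}_{\mathcal{R}}$ is the set of (untyped) terms that reduce in finitely many $\mathcal{R}$-steps to a term containing no $\mathcal{R}$-redex. -}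

module Defs where

open import Data.Nat using (ℕ; zero; suc; _≡ᵇ_; _<ᵇ_; pred)
open import Data.Bool using (if_then_else_)
open import Data.Product using (∃; _×_)
open import Data.Empty using (⊥)
open import Data.Unit using (⊤)
open import Relation.Nullary using (¬_)
open import Relation.Binary.Construct.Closure.ReflexiveTransitive using (Star)

-- λμ-terms, de Bruijn indices; two independent index spaces:
-- λ-variables (bound by lam) and μ-variables (bound by mu).
-- Terms up to α-conversion = de Bruijn terms.
data Tm : Set where
  var : ℕ → Tm
  lam : Tm → Tm
  app : Tm → Tm → Tm
  nam : ℕ → Tm → Tm
  mu  : Tm → Tm

ext : (ℕ → ℕ) → ℕ → ℕ
ext ρ zero    = zero
ext ρ (suc n) = suc (ρ n)

renλ : (ℕ → ℕ) → Tm → Tm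
renλ ρ (var x)   = var (ρ x)
renλ ρ (lam M)   = lam (renλ (ext ρ) M)
renλ ρ (app M N) = app (renλ ρ M) (renλ ρ N)
renλ ρ (nam α M) = nam α (renλ ρ M)
renλ ρ (mu M)    = mu (renλ ρ M)

renμ : (ℕ → ℕ) → Tm → Tm
renμ ρ (var x)   = var x
renμ ρ (lam M)   = lam (renμ ρ M)
renμ ρ (app M N) = app (renμ ρ M) (renμ ρ N)
renμ ρ (nam α M) = nam (ρ α) (renμ ρ M)
renμ ρ (mu M)    = mu (renμ (ext ρ) M)

exts : (ℕ → Tm) → ℕ → Tm
exts σ zero    = var zero
exts σ (suc n) = renλ suc (σ n)

substλ : (ℕ → Tm) → Tm → Tm
substλ σ (var x)   = σ x
substλ σ (lam M)   = lam (substλ (exts σ) M)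
substλ σ (app M N) = app (substλ σ M) (substλ σ N)
substλ σ (nam α M) = nam α (substλ σ M)
substλ σ (mu M)    = mu (substλ (λ n → renμ suc (σ n)) M)

_•λ_ : Tm → (ℕ → Tm)
(N •λ zero)  = N
(N •λ suc n) = var n

_•μ_ : ℕ → ℕ → ℕ
(β •μ zero)  = β
(β •μ suc n) = n

substR : ℕ → Tm → Tm → Tm
substR α N (var x)   = var x
substR α N (lam M)   = lam (substR α (renλ suc N) M)
substR α N (app M P) = app (substR α N M) (substR α N P)
substR α N (nam γ M) =
  if γ ≡ᵇ α then nam γ (app (substR α N M) N) else nam γ (substR α N M)
substR α N (mu M)    = mu (substR (suc α) (renμ suc N) M)

substL : ℕ → Tm → Tm → Tm
substL α N (var x)   = var x
substL α N (lam M)   = lam (substL α (renλ suc N) M)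
substL α N (app M P) = app (substL α N M) (substL α N P)
substL α N (nam γ M) =
  if γ ≡ᵇ α then nam γ (app N (substL α N M)) else nam γ (substL α N M)
substL α N (mu M)    = mu (substL (suc α) (renμ suc N) M)

-- M_β : every [β]P becomes P; since β is the removed binder,
-- μ-indices above β are decremented.
erase : ℕ → Tm → Tm
erase β (var x)   = var x
erase β (lam M)   = lam (erase β M)
erase β (app M N) = app (erase β M) (erase β N)
erase β (nam γ M) =
  if γ ≡ᵇ β then erase β M
  else (if γ <ᵇ β then nam γ (erase β M) else nam (pred γ) (erase β M))
erase β (mu M)    = mu (erase (suc β) M)

data Rule : Set where
  β-rule μ-rule μ'-rule ρ-rule θ-rule ε-rule : Rule

data Contr : Rule → Tm → Tm → Set where
  β  : ∀ M N → Contr β-rule (app (lam M) N) (substλ (N •λ_) M)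
  μ  : ∀ M N → Contr μ-rule (app (mu M) N) (mu (substR zero (renμ suc N) M))
  μ' : ∀ M N → Contr μ'-rule (app N (mu M)) (mu (substL zero (renμ suc N) M))
  ρ  : ∀ b M → Contr ρ-rule (nam b (mu M)) (renμ (b •μ_) M)
  -- μα.[α]M → M with α ∉ fv(M): M is the shift of a term not mentioning α
  θ  : ∀ M → Contr θ-rule (mu (nam zero (renμ suc M))) M
  -- μα.μβ.M → μα.M_β   (β = index 0 inside)
  ε  : ∀ M → Contr ε-rule (mu (mu M)) (mu (erase zero M))

RuleSet : Set₁
RuleSet = Rule → Set

data Step (R : RuleSet) : Tm → Tm → Set where
  root : ∀ {r M N} → R r → Contr r M N → Step R M N
  lamS : ∀ {M M'} → Step R M M' → Step R (lam M) (lam M')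
  appL : ∀ {M M' N} → Step R M M' → Step R (app M N) (app M' N)
  appR : ∀ {M N N'} → Step R N N' → Step R (app M N) (app M N')
  namS : ∀ {α M M'} → Step R M M' → Step R (nam α M) (nam α M')
  muS  : ∀ {M M'} → Step R M M' → Step R (mu M) (mu M')

HasRedex : RuleSet → Tm → Set
HasRedex R M = ∃ λ N → Step R M N

WN : RuleSet → Tm → Set
WN R M = ∃ λ N → Star (Step R) M N × ¬ HasRedex R N

βμμ'ρε : RuleSet
βμμ'ρε θ-rule = ⊥
βμμ'ρε _      = ⊤

βμμ'ρεθ : RuleSet
βμμ'ρεθ _ = ⊤

-- Contract the θ-redexes of a βμμ'ρε-normal form bottom-up (θnf). No new redex appears
-- inside a contractum M of μα.[α]M, since μ-renaming reflects redexes. Outside, M could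
-- only create a redex by being a λ or μ applied to something, a μ applied to, or a μ
-- under [β] or μ; but there the contracted μα.[α]M would already have formed a β-, μ-,
-- μ'-, ρ- or ε-redex.
module Submission where

open import Defs
open import Data.Nat using (ℕ; zero; suc)
open import Data.Maybe using (Maybe; just; nothing; zipWith)
import Data.Maybe as Maybe
open import Data.Product using (∃; _,_)
open import Data.Empty using (⊥)
open import Data.Unit using (⊤; tt)
open import Function using (id)
open import Relation.Nullary using (¬_)
open import Relation.Binary.PropositionalEquality using (_≡_; refl; sym; trans; cong; cong₂)
open import Relation.Binary.Construct.Closure.ReflexiveTransitive using (Star; ε; _◅_; _◅◅_; gmap)

thin : ℕ → ℕ → ℕ
thin zero    = suc
thin (suc c) = ext (thin c)

thick : ℕ → ℕ → Maybe ℕ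
thick zero    zero    = nothing
thick zero    (suc n) = just n
thick (suc c) zero    = just zero
thick (suc c) (suc n) = Maybe.map suc (thick c n)

thick-thin : ∀ c n → thick c (thin c n) ≡ just n
thick-thin zero    n       = refl
thick-thin (suc c) zero    = refl
thick-thin (suc c) (suc n) = cong (Maybe.map suc) (thick-thin c n)

thick≡just⇒thin : ∀ c m {n} → thick c m ≡ just n → m ≡ thin c n
thick≡just⇒thin zero    (suc m) refl = refl
thick≡just⇒thin (suc c) zero    refl = refl
thick≡just⇒thin (suc c) (suc m) eq with thick c m in e
thick≡just⇒thin (suc c) (suc m) refl | just k = cong suc (thick≡just⇒thin c m e)

thickTm : ℕ → Tm → Maybe Tm
thickTm c (var x)   = just (var x)
thickTm c (lam M)   = Maybe.map lam (thickTm c M)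
thickTm c (app M N) = zipWith app (thickTm c M) (thickTm c N)
thickTm c (nam γ M) = zipWith nam (thick c γ) (thickTm c M)
thickTm c (mu M)    = Maybe.map mu (thickTm (suc c) M)

thickTm-thin : ∀ c M → thickTm c (renμ (thin c) M) ≡ just M
thickTm-thin c (var x)   = refl
thickTm-thin c (lam M)   = cong (Maybe.map lam) (thickTm-thin c M)
thickTm-thin c (app M N) = cong₂ (zipWith app) (thickTm-thin c M) (thickTm-thin c N)
thickTm-thin c (nam γ M) = cong₂ (zipWith nam) (thick-thin c γ) (thickTm-thin c M)
thickTm-thin c (mu M)    = cong (Maybe.map mu) (thickTm-thin (suc c) M)

thickTm≡just⇒renμ-thin : ∀ c M {P} → thickTm c M ≡ just P → M ≡ renμ (thin c) P
thickTm≡just⇒renμ-thin c (var x) refl = refl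
thickTm≡just⇒renμ-thin c (lam M) eq with thickTm c M in e
thickTm≡just⇒renμ-thin c (lam M) refl | just M′ = cong lam (thickTm≡just⇒renμ-thin c M e)
thickTm≡just⇒renμ-thin c (app M N) eq with thickTm c M in e₁ | thickTm c N in e₂
thickTm≡just⇒renμ-thin c (app M N) refl | just M′ | just N′ =
  cong₂ app (thickTm≡just⇒renμ-thin c M e₁) (thickTm≡just⇒renμ-thin c N e₂)
thickTm≡just⇒renμ-thin c (nam γ M) eq with thick c γ in e₁ | thickTm c M in e₂
thickTm≡just⇒renμ-thin c (nam γ M) refl | just δ | just M′ =
  cong₂ nam (thick≡just⇒thin c γ e₁) (thickTm≡just⇒renμ-thin c M e₂)
thickTm≡just⇒renμ-thin c (mu M) eq with thickTm (suc c) M in e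
thickTm≡just⇒renμ-thin c (mu M) refl | just M′ = cong mu (thickTm≡just⇒renμ-thin (suc c) M e)

θ-contractum : Tm → Maybe Tm
θ-contractum (nam zero M) = thickTm 0 M
θ-contractum _            = nothing

θ-contractum≡just : ∀ X {P} → θ-contractum X ≡ just P → X ≡ nam zero (renμ suc P)
θ-contractum≡just (nam zero M) eq = cong (nam zero) (thickTm≡just⇒renμ-thin 0 M eq)

ext-fusion : ∀ {f g h : ℕ → ℕ} → (∀ n → g (f n) ≡ h n) → ∀ n → ext g (ext f n) ≡ ext h n
ext-fusion gf≗h zero    = refl
ext-fusion gf≗h (suc n) = cong suc (gf≗h n)

renμ-fusion : ∀ {f g h} → (∀ n → g (f n) ≡ h n) → ∀ M → renμ g (renμ f M) ≡ renμ h M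
renμ-fusion gf≗h (var x)   = refl
renμ-fusion gf≗h (lam M)   = cong lam (renμ-fusion gf≗h M)
renμ-fusion gf≗h (app M N) = cong₂ app (renμ-fusion gf≗h M) (renμ-fusion gf≗h N)
renμ-fusion gf≗h (nam γ M) = cong₂ nam (gf≗h γ) (renμ-fusion gf≗h M)
renμ-fusion gf≗h (mu M)    = cong mu (renμ-fusion (ext-fusion gf≗h) M)

renμ-ext-suc : ∀ f M → renμ (ext f) (renμ suc M) ≡ renμ suc (renμ f M)
renμ-ext-suc f M = trans (renμ-fusion (λ _ → refl) M) (sym (renμ-fusion (λ _ → refl) M))

renμ-contr : ∀ f {r P Q} → Contr r P Q → ∃ λ Q′ → Contr r (renμ f P) Q′
renμ-contr f (β M N)  = _ , β _ _
renμ-contr f (μ M N)  = _ , μ _ _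
renμ-contr f (μ' M N) = _ , μ' _ _
renμ-contr f (ρ b M)  = _ , ρ _ _
renμ-contr f (θ M) rewrite renμ-ext-suc f M = _ , θ _
renμ-contr f (ε M)    = _ , ε _

renμ-reflects-redex : ∀ {R} f {P Q} → Step R P Q → HasRedex R (renμ f P)
renμ-reflects-redex f (root r c) with renμ-contr f c
... | _ , c′ = _ , root r c′
renμ-reflects-redex f (lamS s) with renμ-reflects-redex f s
... | _ , s′ = _ , lamS s′
renμ-reflects-redex f (appL s) with renμ-reflects-redex f s
... | _ , s′ = _ , appL s′
renμ-reflects-redex f (appR s) with renμ-reflects-redex f s
... | _ , s′ = _ , appR s′
renμ-reflects-redex f (namS s) with renμ-reflects-redex f s
... | _ , s′ = _ , namS s′
renμ-reflects-redex f (muS s) with renμ-reflects-redex (ext f) s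
... | _ , s′ = _ , muS s′

Step-mono : ∀ {R S} → (∀ {r} → R r → S r) → ∀ {M N} → Step R M N → Step S M N
Step-mono R⊆S (root r c) = root (R⊆S r) c
Step-mono R⊆S (lamS s)   = lamS (Step-mono R⊆S s)
Step-mono R⊆S (appL s)   = appL (Step-mono R⊆S s)
Step-mono R⊆S (appR s)   = appR (Step-mono R⊆S s)
Step-mono R⊆S (namS s)   = namS (Step-mono R⊆S s)
Step-mono R⊆S (muS s)    = muS (Step-mono R⊆S s)

Normal : RuleSet → Tm → Set
Normal R M = ¬ HasRedex R M

IsLam IsMu : Tm → Set
IsLam (lam _) = ⊤
IsLam _       = ⊥
IsMu (mu _) = ⊤
IsMu _      = ⊥

normal-subterm : ∀ {R M N} (C : Tm → Tm) →
                 (∀ {M′} → Step R M M′ → Step R N (C M′)) → Normal R N → Normal R M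
normal-subterm C lift nf (_ , s) = nf (_ , lift s)

normal-renμ⁻¹ : ∀ {R} f {M} → Normal R (renμ f M) → Normal R M
normal-renμ⁻¹ f nf (_ , s) = nf (renμ-reflects-redex f s)

normal-var : ∀ {R} x → Normal R (var x)
normal-var x (_ , root _ ())

normal-lam : ∀ {R X} → Normal R X → Normal R (lam X)
normal-lam nX (_ , root _ ())
normal-lam nX (_ , lamS s) = nX (_ , s)

normal-app : ∀ {R X Y} → ¬ IsLam X → ¬ IsMu X → ¬ IsMu Y →
             Normal R X → Normal R Y → Normal R (app X Y)
normal-app ¬λX ¬μX ¬μY nX nY (_ , root _ (β M N))  = ¬λX tt
normal-app ¬λX ¬μX ¬μY nX nY (_ , root _ (μ M N))  = ¬μX tt
normal-app ¬λX ¬μX ¬μY nX nY (_ , root _ (μ' M N)) = ¬μY tt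
normal-app ¬λX ¬μX ¬μY nX nY (_ , appL s)          = nX (_ , s)
normal-app ¬λX ¬μX ¬μY nX nY (_ , appR s)          = nY (_ , s)

normal-nam : ∀ {R b X} → ¬ IsMu X → Normal R X → Normal R (nam b X)
normal-nam ¬μX nX (_ , root _ (ρ c M)) = ¬μX tt
normal-nam ¬μX nX (_ , namS s)         = nX (_ , s)

normal-mu : ∀ {R X} → ¬ IsMu X → θ-contractum X ≡ nothing → Normal R X → Normal R (mu X)
normal-mu ¬μX e nX (_ , root _ (θ M)) with trans (sym (thickTm-thin 0 M)) e
... | ()
normal-mu ¬μX e nX (_ , root _ (ε M)) = ¬μX tt
normal-mu ¬μX e nX (_ , muS s)        = nX (_ , s)

normal-app-¬λˡ : ∀ {X Y} → Normal βμμ'ρε (app X Y) → ¬ IsLam X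
normal-app-¬λˡ {lam M} {Y} nf _ = nf (_ , root tt (β M Y))

normal-app-¬μˡ : ∀ {X Y} → Normal βμμ'ρε (app X Y) → ¬ IsMu X
normal-app-¬μˡ {mu M} {Y} nf _ = nf (_ , root tt (μ M Y))

normal-app-¬μʳ : ∀ {X Y} → Normal βμμ'ρε (app X Y) → ¬ IsMu Y
normal-app-¬μʳ {X} {mu M} nf _ = nf (_ , root tt (μ' M X))

normal-nam-¬μ : ∀ {b X} → Normal βμμ'ρε (nam b X) → ¬ IsMu X
normal-nam-¬μ {b} {mu M} nf _ = nf (_ , root tt (ρ b M))

normal-mu-¬μ : ∀ {X} → Normal βμμ'ρε (mu X) → ¬ IsMu X
normal-mu-¬μ {mu M} nf _ = nf (_ , root tt (ε M))

muθ : Tm → Tm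
muθ X with θ-contractum X
... | just P  = P
... | nothing = mu X

muθ-reduces : ∀ X → Star (Step βμμ'ρεθ) (mu X) (muθ X)
muθ-reduces X with θ-contractum X in e
... | nothing = ε
... | just P with refl ← θ-contractum≡just X e = root tt (θ P) ◅ ε

muθ-normal : ∀ {X} → ¬ IsMu X → Normal βμμ'ρεθ X → Normal βμμ'ρεθ (muθ X)
muθ-normal {X} ¬μX nX with θ-contractum X in e
... | nothing = normal-mu ¬μX e nX
... | just P with refl ← θ-contractum≡just X e =
  normal-renμ⁻¹ suc (normal-subterm (nam zero) namS nX)

θnf : Tm → Tm
θnf (var x)   = var x
θnf (lam M)   = lam (θnf M)
θnf (app M N) = app (θnf M) (θnf N)
θnf (nam α M) = nam α (θnf M)
θnf (mu M)    = muθ (θnf M)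

θnf-reduces : ∀ M → Star (Step βμμ'ρεθ) M (θnf M)
θnf-reduces (var x)   = ε
θnf-reduces (lam M)   = gmap lam lamS (θnf-reduces M)
θnf-reduces (app M N) = gmap (λ M′ → app M′ N) appL (θnf-reduces M) ◅◅ gmap (app (θnf M)) appR (θnf-reduces N)
θnf-reduces (nam α M) = gmap (nam α) namS (θnf-reduces M)
θnf-reduces (mu M)    = gmap mu muS (θnf-reduces M) ◅◅ muθ-reduces (θnf M)

θnf-¬μ : ∀ {M} → ¬ IsMu M → ¬ IsMu (θnf M)
θnf-¬μ {var _}   _   ()
θnf-¬μ {lam _}   _   ()
θnf-¬μ {app _ _} _   ()
θnf-¬μ {nam _ _} _   ()
θnf-¬μ {mu _}    ¬μ _ = ¬μ tt

θnf-¬λ : ∀ {M} → ¬ IsLam M → ¬ IsMu M → ¬ IsLam (θnf M)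
θnf-¬λ {var _}   _  _  ()
θnf-¬λ {lam _}   ¬λ _  _ = ¬λ tt
θnf-¬λ {app _ _} _  _  ()
θnf-¬λ {nam _ _} _  _  ()
θnf-¬λ {mu _}    _  ¬μ _ = ¬μ tt

θnf-normal : ∀ M → Normal βμμ'ρε M → Normal βμμ'ρεθ (θnf M)
θnf-normal (var x)   nf = normal-var x
θnf-normal (lam M)   nf = normal-lam (θnf-normal M (normal-subterm lam lamS nf))
θnf-normal (app M N) nf =
  normal-app (θnf-¬λ (normal-app-¬λˡ nf) (normal-app-¬μˡ nf))
             (θnf-¬μ (normal-app-¬μˡ nf))
             (θnf-¬μ (normal-app-¬μʳ nf))
             (θnf-normal M (normal-subterm (λ M′ → app M′ N) appL nf))
             (θnf-normal N (normal-subterm (app M) appR nf))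
θnf-normal (nam α M) nf =
  normal-nam (θnf-¬μ (normal-nam-¬μ nf)) (θnf-normal M (normal-subterm (nam α) namS nf))
θnf-normal (mu M)    nf =
  muθ-normal (θnf-¬μ (normal-mu-¬μ nf)) (θnf-normal M (normal-subterm mu muS nf))

theorem5p3 : (M : Tm) → WN βμμ'ρε M → WN βμμ'ρεθ M
theorem5p3 M (N , M↠N , nf) =
  θnf N , gmap id (Step-mono (λ _ → tt)) M↠N ◅◅ θnf-reduces N , θnf-normal N nf
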